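{- For all bouquets $\Phi,\Psi$: if $\Phi\to^*\Psi$ in the full flower calculus $\mathsf N\cup\mathsf C$, then $\Psi\models\Phi$.
   Context: Fix a countable set $\mathcal{V}$ of variables and a first-order signature: a countable set $\mathcal{P}$ of predicate symbols with arities $\mathrm{ar}:\mathcal{P}\to\mathbb{N}$. Flowers and gardens by mutual induction: atoms $p(\vec x)$ ($\vec x\in\mathcal V^{\mathrm{ar}(p)}$) are flowers; if $\mathbf{x}\subset\mathcal{V}$ is finite (a sprinkler) and $\Phi$ a finite multiset of flowers (a bouquet), $\mathbf{x}\cdot\Phi$ is a garden; if $\gamma$ is a garden (pistil) and $\Delta$ a finite multiset of gardens (corolla of petals), $\gamma\rhd\Delta$ is a flower, also written $\gamma\rhd\delta_1;\dots;\delta_n$. $\emptyset\cdot\Phi$ is written $\Phi$; $\emptyset$ is the empty bouquet; comma is multiset union; $\mathbf x,\mathbf y$ denotes $\mathbf x\cup\mathbf y$. Free variables: $\mathrm{fv}(p(\vec x))$ = variables of $\vec x$; $\mathrm{fv}(\Phi)=\bigcup\mathrm{fv}(\phi)$; $\mathrm{fv}(\mathbf{x}\cdot\Phi)=\mathrm{fv}(\Phi)\setminus\mathbf{x}$; $\mathrm{fv}(\mathbf{x}\cdot\Phi\rhd\Delta)=\mathrm{fv}(\mathbf{x}\cdot\Phi)\cup\bigcup_{\mathbf{y}\cdot\Psi\in\Delta}\mathrm{fv}((\mathbf{x}\cup\mathbf{y})\cdot\Psi)$. Bound variables: $\mathrm{bv}(p(\vec x))=\emptyset$, $\mathrm{bv}(\Phi)=\bigcup\mathrm{bv}(\phi)$,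 $\mathrm{bv}(\mathbf x\cdot\Phi)=\mathbf x\cup\mathrm{bv}(\Phi)$, $\mathrm{bv}(\gamma\rhd\Delta)=\mathrm{bv}(\gamma)\cup\bigcup_{\delta\in\Delta}\mathrm{bv}(\delta)$. Standing convention: every bouquet considered has pairwise distinct binders and $\mathrm{bv}(\Phi)\cap\mathrm{fv}(\Phi)=\emptyset$. Substitutions: $f[R\mapsto g]$ equals $g$ on $R$ and $f$ elsewhere (left-associative; omitted function means identity). A substitution is $\sigma:\mathcal V\to\mathcal V$ with finite support; $\sigma:\mathbf y$ means support $\mathbf y$; $\sigma_{ -\mathbf x}:=\sigma[\mathbf x\mapsto\mathrm{id}]$. Action: $\sigma(p(x_1,\dots,x_n))=p(\sigma(x_1),\dots,\sigma(x_n))$, elementwise on bouquets, $\sigma(\mathbf x\cdot\Phi)=\mathbf x\cdot\sigma_{ -\mathbf x}(\Phi)$, $\sigma(\mathbf x\cdot\Phi\rhd\delta_1;\dots;\delta_n)=\sigma(\mathbf x\cdot\Phi)\rhd\sigma_{ -\mathbf x}(\delta_1);\dots;\sigma_{ -\mathbf x}(\delta_n)$. $\sigma:\mathbf y$ is capture-avoiding in $\Phi$ if $\sigma(\mathbf y)\cap\mathrm{bv}(\Phi)=\emptyset$. Contexts: $\Xi::=\Psi,\xi$, $\xi::=\Box\mid(\mathbf x\cdot\Xi\rhd\Delta)\mid(\gamma\rhd\mathbf x\cdot\Xi;\Delta)$; $\Xi\{\Psi\}$ fills the hole with bouquet $\Psi$, $\Xi\{\}$ with $\emptyset$. Inversions: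 $\mathrm{inv}(\Box)=0$, $\mathrm{inv}(\Psi,\xi)=\mathrm{inv}(\xi)$, $\mathrm{inv}(\mathbf x\cdot\Xi\rhd\Delta)=1+\mathrm{inv}(\Xi)$, $\mathrm{inv}(\gamma\rhd\mathbf x\cdot\Xi;\Delta)=\mathrm{inv}(\Xi)$; positive contexts $\Xi^+$ have even, negative $\Xi^-$ odd inversions. A flower $\phi$ can be pollinated in $\Xi$ if there are a bouquet $\Psi\ni\phi$ and contexts $\Xi',\Xi_0$ with $\Xi=\Xi'\{\Psi,\Xi_0\}$ or $\Xi=\Xi'\{\mathbf x\cdot\Psi\rhd\mathbf y\cdot\Xi_0;\Delta\}$; a bouquet can be pollinated if each of its flowers can. Rules (conclusion $\to$ premiss). Natural $\mathsf N$: (poll↓) $\Xi\{\Phi\}\to\Xi\{\}$, (poll↑) $\Xi\{\}\to\Xi\{\Phi\}$ when $\Phi$ can be pollinated in $\Xi$; (epis) $\Phi\to(\emptyset\cdot\emptyset\rhd\emptyset\cdot\Phi)$; (epet) $(\gamma\rhd\emptyset\cdot\emptyset;\Delta)\to\emptyset$; (srep) $(\mathbf x\cdot(\Phi,(\emptyset\cdot\emptyset\rhd\gamma_1;\dots;\gamma_n))\rhd\Delta)\to(\mathbf x\cdot\Phi\rhd\emptyset\cdot\{(\gamma_1\rhd\Delta),\dots,(\gamma_n\rhd\Delta)\})$; (ipis) $(\mathbf x,\mathbf y\cdot\Phi\rhd\Delta)\to(\mathbf x\cdot\sigma(\Phi)\rhd\sigma(\Delta)),(\mathbf x,\mathbf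 y\cdot\Phi\rhd\Delta)$; (ipet) $(\gamma\rhd\mathbf x,\mathbf y\cdot\Phi;\Delta)\to(\gamma\rhd\mathbf x\cdot\sigma(\Phi);\mathbf x,\mathbf y\cdot\Phi;\Delta)$. Cultural $\mathsf C$: (grow) $\Xi^+\{\}\to\Xi^+\{\Phi\}$; (crop) $\Xi^-\{\Phi\}\to\Xi^-\{\}$; (pull) $\Xi^+\{\gamma\rhd\Gamma;\Delta\}\to\Xi^+\{\gamma\rhd\Delta\}$; (glue) $\Xi^-\{\gamma\rhd\Delta\}\to\Xi^-\{\gamma\rhd\Gamma;\Delta\}$; (apis) $\Xi^+\{\mathbf x\cdot\sigma(\Phi)\rhd\sigma(\Delta)\}\to\Xi^+\{\mathbf x,\mathbf y\cdot\Phi\rhd\Delta\}$; (apet) $\Xi^-\{\gamma\rhd\mathbf x\cdot\sigma(\Phi);\Delta\}\to\Xi^-\{\gamma\rhd\mathbf x,\mathbf y\cdot\Phi;\Delta\}$. In ipis/apis $\sigma:\mathbf y$ is capture-avoiding in $(\emptyset\cdot\Phi\rhd\Delta)$, in ipet/apet in $\Phi$. Natural steps are closed under all contexts ($\Phi\to\Psi$ an $\mathsf N$-instance gives $\Xi\{\Phi\}\to\Xi\{\Psi\}$). $\to^*$ is a finite sequence of steps. Semantics: a Kripke structure $(W,\le,(M_w)_{w\in W})$ has a preorder $\le$ on worlds and, for each $w$, a nonempty domain $M_w$ and relations $[\![p]\!]_w\subseteq M_w^{\mathrm{ar}(p)}$, with $M_w\subseteq M_{w'}$ and $[\![p]\!]_w\subseteq[\![p]\!]_{w'}$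 whenever $w\le w'$. A $w$-evaluation is $e:\mathcal V\to M_w$. Forcing: $w\Vdash_e p(x_1,\dots,x_n)$ iff $(e(x_1),\dots,e(x_n))\in[\![p]\!]_w$; $w\Vdash_e\Phi$ iff $w\Vdash_e\phi$ for all $\phi\in\Phi$; $w\Vdash_e(\mathbf x\cdot\Phi\rhd\mathbf x_1\cdot\Phi_1;\dots;\mathbf x_n\cdot\Phi_n)$ iff for every $w'\ge w$ and $w'$-evaluation $e'$ with $w'\Vdash_{e[\mathbf x\mapsto e']}\Phi$, there are $1\le i\le n$ and a $w'$-evaluation $e''$ with $w'\Vdash_{e[\mathbf x\mapsto e'][\mathbf x_i\mapsto e'']}\Phi_i$. $\Phi\models\Psi$ means that in every Kripke structure, for every world $w$ and $w$-evaluation $e$, $w\Vdash_e\Phi$ implies $w\Vdash_e\Psi$. -}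

module Defs where

open import Data.Nat using (ℕ; _≟_; _%_)
open import Data.List using (List; []; _∷_; _++_; [_]; filter; map)
open import Data.List.Membership.Propositional using (_∈_; _∉_)
open import Data.List.Membership.DecPropositional _≟_ using (_∈?_)
open import Data.List.Relation.Unary.All using (All)
open import Data.List.Relation.Unary.Unique.Propositional using (Unique)
open import Data.List.Relation.Binary.Permutation.Propositional using (_↭_)
open import Data.Vec using (Vec; toList) renaming (map to vmap)
open import Data.Product using (Σ; _×_; _,_)
open import Data.Sum using (_⊎_)
open import Data.Empty using (⊥)
open import Data.Unit using (⊤)
open import Relation.Nullary using (¬_; yes; no; ¬?)
open import Relation.Binary.PropositionalEquality using (_≡_)

-- Conventions
--  * Variables V = ℕ.
--  * Sprinklers (finite sets of variables) are lists of variables; set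
--    equality of sprinklers is a structural-equivalence step (see Struct).
--  * Bouquets and corollas (finite multisets) are lists; reordering is a
--    structural-equivalence step (permutation).
--  * Bouquets are considered up to α-renaming of bound variables
--    (structural-equivalence steps αPis / αPet), and, per the standing
--    convention, a rule may only be applied to a bouquet satisfying the
--    convention (WF: pairwise distinct binders, bv ∩ fv = ∅).

Var : Set
Var = ℕ

Sprinkler : Set
Sprinkler = List Var

-- finite-support substitutions are functions ℕ → ℕ; support is given by Supp
Subst : Set
Subst = Var → Var

_∖ˢ_ : Subst → Sprinkler → Subst
(σ ∖ˢ x) v with v ∈? x
... | yes _ = v
... | no  _ = σ v

minus : List Var → Sprinkler → List Var
minus l x = filter (λ v → ¬? (v ∈? x)) l

_≈ˢ_ : Sprinkler → Sprinkler → Set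
x ≈ˢ y = ∀ v → (v ∈ x → v ∈ y) × (v ∈ y → v ∈ x)

Supp : Subst → Sprinkler → Set
Supp σ y = ∀ v → (v ∈ y → ¬ (σ v ≡ v)) × (¬ (σ v ≡ v) → v ∈ y)

rename : Var → Var → Subst
rename a b v with v ≟ a
... | yes _ = b
... | no  _ = v

module _ {P : Set} (ar : P → ℕ) where

  infix 5 _·_
  infix 4 _▷_

  data Flower : Set
  data Garden : Set

  data Flower where
    atom : (p : P) → Vec Var (ar p) → Flower
    _▷_  : Garden → List Garden → Flower

  data Garden where
    _·_ : Sprinkler → List Flower → Garden

  Bouquet : Set
  Bouquet = List Flower

  subF  : Subst → Flower → Flower
  subG  : Subst → Garden → Garden
  subB  : Subst → Bouquet → Bouquet
  subGs : Subst → List Garden → List Garden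

  subF σ (atom p xs)     = atom p (vmap σ xs)
  subF σ ((x · Φ) ▷ Δ)   = (x · subB (σ ∖ˢ x) Φ) ▷ subGs (σ ∖ˢ x) Δ
  subG σ (y · Ψ)         = y · subB (σ ∖ˢ y) Ψ
  subB σ []              = []
  subB σ (φ ∷ Φ)         = subF σ φ ∷ subB σ Φ
  subGs σ []             = []
  subGs σ (δ ∷ Δ)        = subG σ δ ∷ subGs σ Δ

  fvF   : Flower → List Var
  fvB   : Bouquet → List Var
  fvPet : Sprinkler → List Garden → List Var

  fvF (atom p xs)    = toList xs
  fvF ((x · Φ) ▷ Δ)  = minus (fvB Φ) x ++ fvPet x Δ
  fvB []             = []
  fvB (φ ∷ Φ)        = fvF φ ++ fvB Φ
  fvPet x []              = []
  fvPet x ((y · Ψ) ∷ Δ)   = minus (fvB Ψ) (x ++ y) ++ fvPet x Δ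

  fvG : Garden → List Var
  fvG (x · Φ) = minus (fvB Φ) x

  bvF  : Flower → List Var
  bvB  : Bouquet → List Var
  bvG  : Garden → List Var
  bvGs : List Garden → List Var

  bvF (atom p xs)  = []
  bvF (γ ▷ Δ)      = bvG γ ++ bvGs Δ
  bvG (x · Φ)      = x ++ bvB Φ
  bvB []           = []
  bvB (φ ∷ Φ)      = bvF φ ++ bvB Φ
  bvGs []          = []
  bvGs (δ ∷ Δ)     = bvG δ ++ bvGs Δ

  WF : Bouquet → Set
  WF Φ = Unique (bvB Φ) × (∀ v → v ∈ bvB Φ → v ∉ fvB Φ)

  CapAvoid : Subst → Sprinkler → List Var → Set
  CapAvoid σ y bs = ∀ v → v ∈ y → σ v ∉ bs

  -- Contexts  Ξ ::= Ψ , ξ     ξ ::= □ | (x · Ξ ▷ Δ) | (γ ▷ x · Ξ ; Δ)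

  data Ctx  : Set
  data CtxF : Set

  data Ctx where
    _,,_ : Bouquet → CtxF → Ctx

  data CtxF where
    □   : CtxF
    pis : Sprinkler → Ctx → List Garden → CtxF
    pet : Garden → Sprinkler → Ctx → List Garden → CtxF

  fill  : Ctx → Bouquet → Bouquet
  fillF : CtxF → Bouquet → Bouquet
  fill (Ψ ,, ξ) Φ = Ψ ++ fillF ξ Φ
  fillF □ Φ = Φ
  fillF (pis x Ξ Δ) Φ   = [ (x · fill Ξ Φ) ▷ Δ ]
  fillF (pet γ y Ξ Δ) Φ = [ γ ▷ ((y · fill Ξ Φ) ∷ Δ) ]

  plug : Ctx → Ctx → Ctx
  plug (Ψ ,, □) (Ψ' ,, ξ')      = (Ψ ++ Ψ') ,, ξ'
  plug (Ψ ,, pis x Ξ Δ) Ξ'      = Ψ ,, pis x (plug Ξ Ξ') Δ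
  plug (Ψ ,, pet γ y Ξ Δ) Ξ'    = Ψ ,, pet γ y (plug Ξ Ξ') Δ

  addB : Bouquet → Ctx → Ctx
  addB Ψ (Ψ₀ ,, ξ) = (Ψ ++ Ψ₀) ,, ξ

  inv  : Ctx → ℕ
  invF : CtxF → ℕ
  inv (Ψ ,, ξ) = invF ξ
  invF □ = 0
  invF (pis x Ξ Δ) = ℕ.suc (inv Ξ)
  invF (pet γ y Ξ Δ) = inv Ξ

  Positive : Ctx → Set
  Positive Ξ = inv Ξ % 2 ≡ 0

  Negative : Ctx → Set
  Negative Ξ = inv Ξ % 2 ≡ 1

  Pollinable : Flower → Ctx → Set
  Pollinable φ Ξ =
    Σ Bouquet λ Ψ → φ ∈ Ψ × Σ Ctx λ Ξ' → Σ Ctx λ Ξ₀ →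
      (Ξ ≡ plug Ξ' (addB Ψ Ξ₀))
      ⊎ (Σ Sprinkler λ x → Σ Sprinkler λ y → Σ (List Garden) λ Δ →
           Ξ ≡ plug Ξ' ([] ,, pet (x · Ψ) y Ξ₀ Δ))

  PollinableB : Bouquet → Ctx → Set
  PollinableB Φ Ξ = All (λ φ → Pollinable φ Ξ) Φ

  -- Natural rules (conclusion , premiss), before closure under contexts

  data NRule : Bouquet → Bouquet → Set where
    epis : ∀ Φ → NRule Φ [ ([] · []) ▷ [ [] · Φ ] ]
    epet : ∀ γ Δ → NRule [ γ ▷ (([] · []) ∷ Δ) ] []
    srep : ∀ x Φ Γ Δ →
      NRule [ (x · (Φ ++ [ ([] · []) ▷ Γ ])) ▷ Δ ]
            [ (x · Φ) ▷ [ [] · map (λ γ → γ ▷ Δ) Γ ] ]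
    ipis : ∀ x y Φ Δ σ → Supp σ y → CapAvoid σ y (bvF (([] · Φ) ▷ Δ)) →
      NRule [ ((x ++ y) · Φ) ▷ Δ ]
            ( ((x · subB σ Φ) ▷ subGs σ Δ) ∷ [ ((x ++ y) · Φ) ▷ Δ ] )
    ipet : ∀ γ x y Φ Δ σ → Supp σ y → CapAvoid σ y (bvB Φ) →
      NRule [ γ ▷ (((x ++ y) · Φ) ∷ Δ) ]
            [ γ ▷ ((x · subB σ Φ) ∷ ((x ++ y) · Φ) ∷ Δ) ]

  -- One rule step of N ∪ C (conclusion → premiss)

  data Step : Bouquet → Bouquet → Set where
    nat   : ∀ Ξ {Φ Ψ} → NRule Φ Ψ → Step (fill Ξ Φ) (fill Ξ Ψ)
    poll↓ : ∀ Ξ Φ → PollinableB Φ Ξ → Step (fill Ξ Φ) (fill Ξ [])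
    poll↑ : ∀ Ξ Φ → PollinableB Φ Ξ → Step (fill Ξ []) (fill Ξ Φ)
    grow  : ∀ Ξ Φ → Positive Ξ → Step (fill Ξ []) (fill Ξ Φ)
    crop  : ∀ Ξ Φ → Negative Ξ → Step (fill Ξ Φ) (fill Ξ [])
    pull  : ∀ Ξ γ Γ Δ → Positive Ξ →
      Step (fill Ξ [ γ ▷ (Γ ++ Δ) ]) (fill Ξ [ γ ▷ Δ ])
    glue  : ∀ Ξ γ Γ Δ → Negative Ξ →
      Step (fill Ξ [ γ ▷ Δ ]) (fill Ξ [ γ ▷ (Γ ++ Δ) ])
    apis  : ∀ Ξ x y Φ Δ σ → Positive Ξ → Supp σ y →
      CapAvoid σ y (bvF (([] · Φ) ▷ Δ)) →
      Step (fill Ξ [ (x · subB σ Φ) ▷ subGs σ Δ ])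
           (fill Ξ [ ((x ++ y) · Φ) ▷ Δ ])
    apet  : ∀ Ξ γ x y Φ Δ σ → Negative Ξ → Supp σ y →
      CapAvoid σ y (bvB Φ) →
      Step (fill Ξ [ γ ▷ ((x · subB σ Φ) ∷ Δ) ])
           (fill Ξ [ γ ▷ (((x ++ y) · Φ) ∷ Δ) ])

  data Struct : Bouquet → Bouquet → Set where
    perm    : ∀ {Φ Φ'} → Φ ↭ Φ' → Struct Φ Φ'
    corolla : ∀ γ {Δ Δ'} → Δ ↭ Δ' → Struct [ γ ▷ Δ ] [ γ ▷ Δ' ]
    sprPis  : ∀ {x x'} Φ Δ → x ≈ˢ x' →
      Struct [ (x · Φ) ▷ Δ ] [ (x' · Φ) ▷ Δ ]
    sprPet  : ∀ γ {y y'} Ψ Δ → y ≈ˢ y' →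
      Struct [ γ ▷ ((y · Ψ) ∷ Δ) ] [ γ ▷ ((y' · Ψ) ∷ Δ) ]
    αPis    : ∀ x Φ Δ a b → a ∈ x → b ∉ x →
      b ∉ fvF (([] · Φ) ▷ Δ) → b ∉ bvF (([] · Φ) ▷ Δ) →
      Struct [ (x · Φ) ▷ Δ ]
             [ (map (rename a b) x · subB (rename a b) Φ) ▷ subGs (rename a b) Δ ]
    αPet    : ∀ γ y Ψ Δ a b → a ∈ y → b ∉ y →
      b ∉ fvB Ψ → b ∉ bvB Ψ →
      Struct [ γ ▷ ((y · Ψ) ∷ Δ) ]
             [ γ ▷ ((map (rename a b) y · subB (rename a b) Ψ) ∷ Δ) ]

  StructStep : Bouquet → Bouquet → Set
  StructStep Φ Ψ = Σ Ctx λ Ξ → Σ Bouquet λ Φ₀ → Σ Bouquet λ Ψ₀ →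
    (Struct Φ₀ Ψ₀ ⊎ Struct Ψ₀ Φ₀) × Φ ≡ fill Ξ Φ₀ × Ψ ≡ fill Ξ Ψ₀

  data _⟶*_ : Bouquet → Bouquet → Set where
    done  : ∀ {Φ} → Φ ⟶* Φ
    rule  : ∀ {Φ Ψ Χ} → WF Φ → Step Φ Ψ → Ψ ⟶* Χ → Φ ⟶* Χ
    equiv : ∀ {Φ Ψ Χ} → StructStep Φ Ψ → Ψ ⟶* Χ → Φ ⟶* Χ

  -- Kripke semantics.  Domains are subsets of an ambient set D, so that
  -- M_w ⊆ M_w' is literal inclusion.

  record Kripke : Set₁ where
    field
      W      : Set
      _≤_    : W → W → Set
      ≤-refl  : ∀ {w} → w ≤ w
      ≤-trans : ∀ {u v w} → u ≤ v → v ≤ w → u ≤ w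
      D      : Set
      M      : W → D → Set
      nonempty : ∀ w → Σ D (M w)
      M-mono : ∀ {w w'} → w ≤ w' → ∀ d → M w d → M w' d
      ⟦_⟧    : (p : P) → W → Vec D (ar p) → Set
      ⟦⟧-dom : ∀ p w ds → ⟦ p ⟧ w ds → All (M w) (toList ds)
      ⟦⟧-mono : ∀ p {w w'} → w ≤ w' → ∀ ds → ⟦ p ⟧ w ds → ⟦ p ⟧ w' ds

  module Forcing (K : Kripke) where
    open Kripke K

    Val : Set
    Val = Var → D

    IsEval : W → Val → Set
    IsEval w e = ∀ v → M w (e v)

    upd : Val → Sprinkler → Val → Val
    upd e x e' v with v ∈? x
    ... | yes _ = e' v
    ... | no  _ = e v

    forceF : W → Val → Flower → Set
    forceB : W → Val → Bouquet → Set
    somePetal : W → Val → List Garden → Set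

    forceF w e (atom p xs) = ⟦ p ⟧ w (vmap e xs)
    forceF w e ((x · Φ) ▷ Δ) =
      ∀ w' → w ≤ w' → ∀ e' → IsEval w' e' →
        forceB w' (upd e x e') Φ → somePetal w' (upd e x e') Δ
    forceB w e []      = ⊤
    forceB w e (φ ∷ Φ) = forceF w e φ × forceB w e Φ
    somePetal w e []             = ⊥
    somePetal w e ((y · Ψ) ∷ Δ)  =
      (Σ Val λ e'' → IsEval w e'' × forceB w (upd e y e'') Ψ) ⊎ somePetal w e Δ

  _⊨_ : Bouquet → Bouquet → Set₁
  Φ ⊨ Ψ = ∀ (K : Kripke) → let open Kripke K; open Forcing K in
    ∀ (w : W) (e : Val) → IsEval w e → forceB w e Φ → forceB w e Ψ

{-# OPTIONS --safe #-}

-- Local entailment is preserved by positive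
-- contexts and reversed by negative ones (a pistil is the antecedent of an implication), and the
-- natural rules are local equivalences, hence sound in every context.  The semantic content lies
-- in three facts: forcing depends only on the free variables; forcing σ(Φ) under ρ is forcing Φ
-- under ρ ∘ σ when σ is capture-avoiding, which yields instantiation and α-renaming; and a forced
-- flower may be added or removed anywhere in its scope, because the standing convention keeps its
-- free variables away from every binder on the way.

module Submission where

open import Defs
open import Data.Nat using (ℕ; zero; suc; _%_) renaming (_≟_ to _≟ℕ_)
open import Data.Empty using (⊥; ⊥-elim)
open import Data.Unit using (tt)
open import Data.Product using (Σ; _×_; _,_; proj₁; proj₂; uncurry)
open import Data.Sum using (_⊎_; inj₁; inj₂; [_,_]′; map₁)
open import Data.Vec using (Vec; toList) renaming (map to vmap; [] to v[]; _∷_ to _v∷_)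
open import Data.Vec.Properties using (map-∘)
open import Data.Product.Function.NonDependent.Propositional using (_×-⇔_)
open import Data.Sum.Function.Propositional using (_⊎-⇔_)
import Function.Properties.Equivalence as ⇔
open import Data.List using (List; []; _∷_; _++_; [_]; map)
open import Data.List.Properties using (++-assoc; ++-identityʳ)
open import Data.List.Membership.Propositional using (_∈_; _∉_)
open import Data.List.Membership.Propositional.Properties
  using (∈-++⁺ˡ; ∈-++⁺ʳ; ∈-++⁻; ∈-filter⁺; ∈-filter⁻; ∈-map⁺; ∈-map⁻)
open import Data.List.Membership.DecPropositional _≟ℕ_ using (_∈?_)
open import Data.List.Relation.Unary.Any using (here; there)
open import Data.List.Relation.Unary.All as All using ([]; _∷_)
open import Data.List.Relation.Unary.AllPairs using ([]; _∷_)
open import Data.List.Relation.Unary.Unique.Propositional using (Unique)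
open import Data.List.Relation.Binary.Disjoint.Propositional using (Disjoint)
open import Data.List.Relation.Binary.Sublist.Propositional
  using (_⊆_; []; _∷_; _∷ʳ_; ⊆-refl; ⊆-trans; ⊆-reflexive)
open import Data.List.Relation.Binary.Sublist.Propositional.Properties
  using (All-resp-⊆; Any-resp-⊆; ++⁺ˡ; ++⁺ʳ; ++⁺)
open import Data.List.Relation.Binary.Permutation.Propositional
  using (_↭_; prep; swap; ↭-sym) renaming (refl to ↭-refl; trans to ↭-trans)
open import Function using (_∘_; id; _⇔_; mk⇔; Equivalence)
open import Function.Definitions using (Injective)
open import Relation.Nullary using (Dec; yes; no; ¬?)
open import Relation.Binary.PropositionalEquality
  using (_≡_; _≢_; _≗_; refl; sym; trans; cong; cong₂; subst; subst₂)

open Equivalence using (to; from)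

Unique-resp-⊇ : ∀ {xs ys : List Var} → xs ⊆ ys → Unique ys → Unique xs
Unique-resp-⊇ [] [] = []
Unique-resp-⊇ (_ ∷ʳ xs⊆ys) (_ ∷ u) = Unique-resp-⊇ xs⊆ys u
Unique-resp-⊇ (refl ∷ xs⊆ys) (x∉ys ∷ u) = All-resp-⊆ xs⊆ys x∉ys ∷ Unique-resp-⊇ xs⊆ys u

Unique-++⇒Disjoint : ∀ (xs : List Var) {ys} → Unique (xs ++ ys) → Disjoint xs ys
Unique-++⇒Disjoint (x ∷ xs) (x∉ ∷ _) (here refl , v∈ys) = All.lookup x∉ (∈-++⁺ʳ xs v∈ys) refl
Unique-++⇒Disjoint (x ∷ xs) (_ ∷ u) (there v∈xs , v∈ys) = Unique-++⇒Disjoint xs u (v∈xs , v∈ys)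

Disjoint-++⁻ : ∀ {xs : List Var} ys {zs} →
  Disjoint xs (ys ++ zs) → Disjoint xs ys × Disjoint xs zs
Disjoint-++⁻ ys d = (λ (p , q) → d (p , ∈-++⁺ˡ q)) , (λ (p , q) → d (p , ∈-++⁺ʳ ys q))

∈-minus⁺ : ∀ {v l} x → v ∈ l → v ∉ x → v ∈ minus l x
∈-minus⁺ x = ∈-filter⁺ (λ u → ¬? (u ∈? x))

∈-minus⁻ : ∀ {v} l x → v ∈ minus l x → v ∈ l × v ∉ x
∈-minus⁻ l x = ∈-filter⁻ (λ u → ¬? (u ∈? x))

suc-even⇒odd : ∀ n → suc n % 2 ≡ 0 → n % 2 ≡ 1
suc-even⇒odd (suc zero) _ = refl
suc-even⇒odd (suc (suc n)) = suc-even⇒odd n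

suc-odd⇒even : ∀ n → suc n % 2 ≡ 1 → n % 2 ≡ 0
suc-odd⇒even zero _ = refl
suc-odd⇒even (suc (suc n)) = suc-odd⇒even n

even-or-odd : ∀ n → n % 2 ≡ 0 ⊎ n % 2 ≡ 1
even-or-odd zero = inj₁ refl
even-or-odd (suc zero) = inj₂ refl
even-or-odd (suc (suc n)) = even-or-odd n

≈ˢ-sym : ∀ {x y} → x ≈ˢ y → y ≈ˢ x
≈ˢ-sym eq v = proj₂ (eq v) , proj₁ (eq v)

NoCapture : Subst → List Var → Set
NoCapture σ l = ∀ v → σ v ≢ v → σ v ∉ l

NoCapture-⊆ : ∀ {σ l l'} → (∀ {v} → v ∈ l' → v ∈ l) → NoCapture σ l → NoCapture σ l'
NoCapture-⊆ l'⊆l c v moved = c v moved ∘ l'⊆l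

NoCapture-∖ˢ : ∀ {σ} x l → NoCapture σ (x ++ l) → NoCapture (σ ∖ˢ x) l
NoCapture-∖ˢ x l c v with v ∈? x
... | yes _ = λ moved _ → moved refl
... | no _ = λ moved → c v moved ∘ ∈-++⁺ʳ x

rename-self : ∀ a b → rename a b a ≡ b
rename-self a b with a ≟ℕ a
... | yes _ = refl
... | no a≢a = ⊥-elim (a≢a refl)

rename-other : ∀ {a b v} → v ≢ a → rename a b v ≡ v
rename-other {a} {v = v} v≢a with v ≟ℕ a
... | yes v≡a = ⊥-elim (v≢a v≡a)
... | no _ = refl

rename-inverse : ∀ {a b v} → v ≢ b → rename b a (rename a b v) ≡ v
rename-inverse {a} {b} {v} v≢b with v ≟ℕ a
... | yes refl = rename-self b a
... | no _ = rename-other v≢b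

NoCapture-rename : ∀ {a b l} → b ∉ l → NoCapture (rename a b) l
NoCapture-rename {a} b∉l v with v ≟ℕ a
... | yes _ = λ _ → b∉l
... | no _ = λ moved _ → moved refl

∉-map-rename : ∀ {a b v x} → v ∉ x → v ≢ b → v ∉ map (rename a b) x
∉-map-rename {a} v∉x v≢b v∈ with ∈-map⁻ (rename a _) v∈
... | u , u∈x , v≡ with u ≟ℕ a
...   | yes _ = v≢b v≡
...   | no _ = v∉x (subst (_∈ _) (sym v≡) u∈x)

module Binding {P : Set} (ar : P → ℕ) where

  ∈-fvB : ∀ {v φ Φ} → φ ∈ Φ → v ∈ fvB ar [ φ ] → v ∈ fvB ar Φ
  ∈-fvB {v} {φ} (here refl) m = ∈-++⁺ˡ (subst (v ∈_) (++-identityʳ (fvF ar φ)) m)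
  ∈-fvB {Φ = ψ ∷ Φ} (there φ∈Φ) m = ∈-++⁺ʳ (fvF ar ψ) (∈-fvB φ∈Φ m)

  ∈-fvB-++ʳ : ∀ Ψ {B v} → v ∈ fvB ar B → v ∈ fvB ar (Ψ ++ B)
  ∈-fvB-++ʳ [] m = m
  ∈-fvB-++ʳ (φ ∷ Ψ) m = ∈-++⁺ʳ (fvF ar φ) (∈-fvB-++ʳ Ψ m)

  fvPet-[]⇒ : ∀ x Δ {v} → v ∈ fvPet ar [] Δ → v ∉ x → v ∈ fvPet ar x Δ
  fvPet-[]⇒ x ((z · Θ) ∷ Δ) m v∉x with ∈-++⁻ (minus (fvB ar Θ) z) m
  ... | inj₁ m' =
    let (f , v∉z) = ∈-minus⁻ (fvB ar Θ) z m' in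
    ∈-++⁺ˡ (∈-minus⁺ (x ++ z) f ([ v∉x , v∉z ]′ ∘ ∈-++⁻ x))
  ... | inj₂ m' = ∈-++⁺ʳ _ (fvPet-[]⇒ x Δ m' v∉x)

  ∈-bvGs : ∀ {v y Ψ Γ} → (y · Ψ) ∈ Γ → v ∈ y → v ∈ bvGs ar Γ
  ∈-bvGs (here refl) v∈y = ∈-++⁺ˡ (∈-++⁺ˡ v∈y)
  ∈-bvGs {Γ = γ ∷ Γ} (there i) v∈y = ∈-++⁺ʳ (bvG ar γ) (∈-bvGs i v∈y)

  ⊆-bvB-++ʳ : ∀ Ψ {B xs} → xs ⊆ bvB ar B → xs ⊆ bvB ar (Ψ ++ B)
  ⊆-bvB-++ʳ [] p = p
  ⊆-bvB-++ʳ (φ ∷ Ψ) p = ++⁺ˡ (bvF ar φ) (⊆-bvB-++ʳ Ψ p)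

  binders : Ctx ar → List Var
  bindersF : CtxF ar → List Var
  binders (Ψ ,, ξ) = bindersF ξ
  bindersF □ = []
  bindersF (pis x Ξ Δ) = x ++ binders Ξ
  bindersF (pet (x · Φ) y Ξ Δ) = x ++ y ++ binders Ξ

  fill-plug : ∀ Ξ Ξ' B → fill ar (plug ar Ξ Ξ') B ≡ fill ar Ξ (fill ar Ξ' B)
  fill-plug (Ψ ,, □) (Ψ' ,, ξ') B = ++-assoc Ψ Ψ' _
  fill-plug (Ψ ,, pis x Ξ Δ) Ξ' B = cong (λ F → Ψ ++ [ (x · F) ▷ Δ ]) (fill-plug Ξ Ξ' B)
  fill-plug (Ψ ,, pet γ y Ξ Δ) Ξ' B = cong (λ F → Ψ ++ [ γ ▷ ((y · F) ∷ Δ) ]) (fill-plug Ξ Ξ' B)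

  fv-fill : ∀ Ξ C {v} → v ∈ fvB ar C → v ∈ fvB ar (fill ar Ξ C) ⊎ v ∈ binders Ξ
  fv-fill (Ψ ,, □) C f = inj₁ (∈-fvB-++ʳ Ψ f)
  fv-fill (Ψ ,, pis x Ξ Δ) C {v} f with fv-fill Ξ C f | v ∈? x
  ... | inj₂ c | _ = inj₂ (∈-++⁺ʳ x c)
  ... | inj₁ _ | yes v∈x = inj₂ (∈-++⁺ˡ v∈x)
  ... | inj₁ f' | no v∉x = inj₁ (∈-fvB-++ʳ Ψ (∈-++⁺ˡ (∈-++⁺ˡ (∈-minus⁺ x f' v∉x))))
  fv-fill (Ψ ,, pet (x · Φ) y Ξ Δ) C {v} f with fv-fill Ξ C f | v ∈? (x ++ y)
  ... | inj₂ c | _ = inj₂ (∈-++⁺ʳ x (∈-++⁺ʳ y c))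
  ... | inj₁ _ | yes v∈xy = inj₂ (subst (v ∈_) (++-assoc x y _) (∈-++⁺ˡ v∈xy))
  ... | inj₁ f' | no v∉xy =
    inj₁ (∈-fvB-++ʳ Ψ (∈-++⁺ˡ (∈-++⁺ʳ (minus (fvB ar Φ) x)
      (∈-++⁺ˡ (∈-minus⁺ (x ++ y) f' v∉xy)))))

  binders++bv⊆bv-fill : ∀ Ξ C → binders Ξ ++ bvB ar C ⊆ bvB ar (fill ar Ξ C)
  binders++bv⊆bv-fill (Ψ ,, □) C = ⊆-bvB-++ʳ Ψ ⊆-refl
  binders++bv⊆bv-fill (Ψ ,, pis x Ξ Δ) C =
    ⊆-bvB-++ʳ Ψ (⊆-trans (⊆-reflexive (++-assoc x _ _))
      (++⁺ʳ [] (++⁺ʳ (bvGs ar Δ) (++⁺ ⊆-refl (binders++bv⊆bv-fill Ξ C)))))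
  binders++bv⊆bv-fill (Ψ ,, pet (x · Φ) y Ξ Δ) C =
    ⊆-bvB-++ʳ Ψ (⊆-trans (⊆-reflexive (trans (++-assoc x _ _) (cong (x ++_) (++-assoc y _ _))))
      (++⁺ʳ [] (++⁺ (++⁺ʳ (bvB ar Φ) (⊆-refl {x = x}))
                    (++⁺ʳ (bvGs ar Δ) (++⁺ ⊆-refl (binders++bv⊆bv-fill Ξ C))))))

  fill-binders-unique : ∀ Ξ C → WF ar (fill ar Ξ C) → Unique (binders Ξ)
  fill-binders-unique Ξ C (u , _) =
    Unique-resp-⊇ (⊆-trans (++⁺ʳ _ ⊆-refl) (binders++bv⊆bv-fill Ξ C)) u

  fill-binders-fresh : ∀ Ξ C → WF ar (fill ar Ξ C) → Disjoint (fvB ar (fill ar Ξ C)) (binders Ξ)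
  fill-binders-fresh Ξ C (_ , fresh) (f , c) =
    fresh _ (Any-resp-⊆ (binders++bv⊆bv-fill Ξ C) (∈-++⁺ˡ c)) f

  WF-fill⁻ : ∀ Ξ C → WF ar (fill ar Ξ C) → WF ar C
  WF-fill⁻ Ξ C (u , fresh) = Unique-resp-⊇ (++⁺ˡ (binders Ξ) ⊆-refl) u' , no-capture
    where
    u' : Unique (binders Ξ ++ bvB ar C)
    u' = Unique-resp-⊇ (binders++bv⊆bv-fill Ξ C) u
    no-capture : ∀ v → v ∈ bvB ar C → v ∉ fvB ar C
    no-capture v b f with fv-fill Ξ C f
    ... | inj₁ f' = fresh v (Any-resp-⊆ (binders++bv⊆bv-fill Ξ C) (∈-++⁺ʳ (binders Ξ) b)) f'
    ... | inj₂ c = Unique-++⇒Disjoint (binders Ξ) u' (c , b)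

  CapAvoid⇒NoCapture : ∀ {σ y bs} → Supp σ y → CapAvoid ar σ y bs → NoCapture σ bs
  CapAvoid⇒NoCapture supp ca v moved = ca v (proj₂ (supp v) moved)

  -- A binder of a petal of Γ is bound in the flower; a free variable of Δ is bound by x or free.
  srep-fresh : ∀ x Φ Γ Δ → WF ar [ (x · (Φ ++ [ ([] · []) ▷ Γ ])) ▷ Δ ] →
    ∀ {y Ψ} → (y · Ψ) ∈ Γ → Disjoint y (fvPet ar [] Δ)
  srep-fresh x Φ Γ Δ (u , fresh) y∈Γ {v} (v∈y , f) = by-cases (v ∈? x)
    where
    bound : v ∈ bvB ar (Φ ++ [ ([] · []) ▷ Γ ])
    bound = Any-resp-⊆ (⊆-bvB-++ʳ Φ ⊆-refl) (∈-++⁺ˡ (∈-bvGs y∈Γ v∈y))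
    by-cases : Dec (v ∈ x) → ⊥
    by-cases (yes v∈x) =
      Unique-++⇒Disjoint x (Unique-resp-⊇ (++⁺ʳ [] (++⁺ʳ (bvGs ar Δ) ⊆-refl)) u) (v∈x , bound)
    by-cases (no v∉x) = fresh v (∈-++⁺ˡ (∈-++⁺ˡ (∈-++⁺ʳ x bound)))
      (∈-++⁺ˡ (∈-++⁺ʳ (minus (fvB ar (Φ ++ [ ([] · []) ▷ Γ ])) x) (fvPet-[]⇒ x Δ f v∉x)))

module Soundness {P : Set} (ar : P → ℕ) (K : Kripke ar) where
  open Kripke K
  open Forcing ar K
  open Binding ar

  private variable
    w w' : W
    e e' e₁ e₂ ρ : Val
    x y : Sprinkler
    φ : Flower ar
    Φ Ψ Θ A B : Bouquet ar
    Γ Δ Δ' : List (Garden ar)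

  IsEval-mono : w ≤ w' → IsEval w e → IsEval w' e
  IsEval-mono le ev v = M-mono le _ (ev v)

  upd-IsEval : ∀ x → IsEval w e → IsEval w e₁ → IsEval w (upd e x e₁)
  upd-IsEval x ev ev₁ v with v ∈? x
  ... | yes _ = ev₁ v
  ... | no _ = ev v

  upd-∈ : ∀ {v} → v ∈ x → upd e x e₁ v ≡ e₁ v
  upd-∈ {x = x} {v = v} v∈x with v ∈? x
  ... | yes _ = refl
  ... | no v∉x = ⊥-elim (v∉x v∈x)

  upd-∉ : ∀ {v} → v ∉ x → upd e x e₁ v ≡ e v
  upd-∉ {x = x} {v = v} v∉x with v ∈? x
  ... | yes v∈x = ⊥-elim (v∉x v∈x)
  ... | no _ = refl

  upd-[] : ∀ e e₁ → upd e [] e₁ ≗ e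
  upd-[] e e₁ v = upd-∉ {x = []} {e = e} {e₁ = e₁} (λ ())

  upd-≈ˢ : ∀ {x'} → x ≈ˢ x' → upd e x e₁ ≗ upd e x' e₁
  upd-≈ˢ {x = x} {x' = x'} eq v with v ∈? x | v ∈? x'
  ... | yes _ | yes _ = refl
  ... | yes v∈x | no v∉x' = ⊥-elim (v∉x' (proj₁ (eq v) v∈x))
  ... | no v∉x | yes v∈x' = ⊥-elim (v∉x (proj₂ (eq v) v∈x'))
  ... | no _ | no _ = refl

  forceF-mono : ∀ φ → w ≤ w' → forceF w e φ → forceF w' e φ
  forceB-mono : ∀ Φ → w ≤ w' → forceB w e Φ → forceB w' e Φ
  somePetal-mono : ∀ Δ → w ≤ w' → somePetal w e Δ → somePetal w' e Δ
  forceF-mono {e = e} (atom p xs) le = ⟦⟧-mono p le (vmap e xs)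
  forceF-mono ((x · Φ) ▷ Δ) le f w'' le' = f w'' (≤-trans le le')
  forceB-mono [] le _ = tt
  forceB-mono (φ ∷ Φ) le (f , g) = forceF-mono φ le f , forceB-mono Φ le g
  somePetal-mono ((y · Ψ) ∷ Δ) le (inj₁ (e₂ , ev₂ , h)) =
    inj₁ (e₂ , IsEval-mono le ev₂ , forceB-mono Ψ le h)
  somePetal-mono ((y · Ψ) ∷ Δ) le (inj₂ h) = inj₂ (somePetal-mono Δ le h)

  Agree : Val → Val → List Var → Set
  Agree e e' l = ∀ {v} → v ∈ l → e v ≡ e' v

  upd-agree : ∀ x {l} → Agree e e' (minus l x) → Agree (upd e x e₁) (upd e' x e₁) l
  upd-agree x h {v} m with v ∈? x
  ... | yes _ = refl
  ... | no v∉x = h (∈-minus⁺ x m v∉x)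

  vmap-agree : ∀ {n} (xs : Vec Var n) → Agree e e' (toList xs) → vmap e xs ≡ vmap e' xs
  vmap-agree v[] h = refl
  vmap-agree (x v∷ xs) h = cong₂ _v∷_ (h (here refl)) (vmap-agree xs (h ∘ there))

  forceF-agree : ∀ φ → Agree e e' (fvF ar φ) → forceF w e φ → forceF w e' φ
  forceB-agree : ∀ Φ → Agree e e' (fvB ar Φ) → forceB w e Φ → forceB w e' Φ
  somePetal-agree : ∀ Δ → Agree e e' (fvPet ar [] Δ) → somePetal w e Δ → somePetal w e' Δ
  forceF-agree {w = w} (atom p xs) h = subst (⟦ p ⟧ w) (vmap-agree xs h)
  forceF-agree ((x · Φ) ▷ Δ) h f w' le e₁ ev₁ hΦ =
    somePetal-agree Δ (upd-agree x (λ m → h (∈-++⁺ʳ _ (uncurry (fvPet-[]⇒ x Δ) (∈-minus⁻ _ x m)))))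
      (f w' le e₁ ev₁ (forceB-agree Φ (λ m → sym (upd-agree x (λ m' → h (∈-++⁺ˡ m')) m)) hΦ))
  forceB-agree [] h _ = tt
  forceB-agree (φ ∷ Φ) h (f , g) =
    forceF-agree φ (λ m → h (∈-++⁺ˡ m)) f , forceB-agree Φ (λ m → h (∈-++⁺ʳ (fvF ar φ) m)) g
  somePetal-agree ((z · Θ) ∷ Δ) h (inj₁ (e₂ , ev₂ , t)) =
    inj₁ (e₂ , ev₂ , forceB-agree Θ (upd-agree z (λ m → h (∈-++⁺ˡ m))) t)
  somePetal-agree ((z · Θ) ∷ Δ) h (inj₂ s) = inj₂ (somePetal-agree Δ (λ m → h (∈-++⁺ʳ _ m)) s)

  forceB-resp-≗ : ∀ Φ → e ≗ e' → forceB w e Φ → forceB w e' Φ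
  forceB-resp-≗ Φ eq = forceB-agree Φ (λ {v} _ → eq v)

  somePetal-resp-≗ : ∀ Δ → e ≗ e' → somePetal w e Δ → somePetal w e' Δ
  somePetal-resp-≗ Δ eq = somePetal-agree Δ (λ {v} _ → eq v)

  forceB-≗-⇔ : ∀ Φ → e ≗ e' → forceB w e Φ ⇔ forceB w e' Φ
  forceB-≗-⇔ Φ eq = mk⇔ (forceB-resp-≗ Φ eq) (forceB-resp-≗ Φ (sym ∘ eq))

  somePetal-≗-⇔ : ∀ Δ → e ≗ e' → somePetal w e Δ ⇔ somePetal w e' Δ
  somePetal-≗-⇔ Δ eq = mk⇔ (somePetal-resp-≗ Δ eq) (somePetal-resp-≗ Δ (sym ∘ eq))

  forceB-upd-fresh : ∀ Θ → Disjoint (fvB ar Θ) x → forceB w e Θ → forceB w (upd e x e₁) Θ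
  forceB-upd-fresh Θ fresh = forceB-agree Θ (λ m → sym (upd-∉ (λ v∈x → fresh (m , v∈x))))

  forceB-++⁻ : ∀ A → forceB w e (A ++ B) → forceB w e A × forceB w e B
  forceB-++⁻ [] h = tt , h
  forceB-++⁻ (φ ∷ A) (f , h) = let (a , b) = forceB-++⁻ A h in (f , a) , b

  forceB-++⁺ : ∀ A → forceB w e A → forceB w e B → forceB w e (A ++ B)
  forceB-++⁺ [] _ b = b
  forceB-++⁺ (φ ∷ A) (f , a) b = f , forceB-++⁺ A a b

  forceB-∈ : φ ∈ Φ → forceB w e Φ → forceF w e φ
  forceB-∈ (here refl) (f , _) = f
  forceB-∈ (there i) (_ , h) = forceB-∈ i h

  forceB-resp-↭ : A ↭ B → forceB w e A → forceB w e B
  forceB-resp-↭ ↭-refl h = h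
  forceB-resp-↭ (prep _ p) (f , h) = f , forceB-resp-↭ p h
  forceB-resp-↭ (swap _ _ p) (f , g , h) = g , f , forceB-resp-↭ p h
  forceB-resp-↭ (↭-trans p q) = forceB-resp-↭ q ∘ forceB-resp-↭ p

  Witnessed : W → Val → Sprinkler → Bouquet ar → Set
  Witnessed w e y Ψ = Σ Val λ e₂ → IsEval w e₂ × forceB w (upd e y e₂) Ψ

  somePetal-++⁺ʳ : ∀ Γ → somePetal w e Δ → somePetal w e (Γ ++ Δ)
  somePetal-++⁺ʳ [] s = s
  somePetal-++⁺ʳ ((_ · _) ∷ Γ) s = inj₂ (somePetal-++⁺ʳ Γ s)

  somePetal-resp-↭ : Δ ↭ Δ' → somePetal w e Δ → somePetal w e Δ'
  somePetal-resp-↭ ↭-refl s = s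
  somePetal-resp-↭ (prep (_ · _) p) (inj₁ t) = inj₁ t
  somePetal-resp-↭ (prep (_ · _) p) (inj₂ s) = inj₂ (somePetal-resp-↭ p s)
  somePetal-resp-↭ (swap (_ · _) (_ · _) p) (inj₁ t) = inj₂ (inj₁ t)
  somePetal-resp-↭ (swap (_ · _) (_ · _) p) (inj₂ (inj₁ t)) = inj₁ t
  somePetal-resp-↭ (swap (_ · _) (_ · _) p) (inj₂ (inj₂ s)) = inj₂ (inj₂ (somePetal-resp-↭ p s))
  somePetal-resp-↭ (↭-trans p q) = somePetal-resp-↭ q ∘ somePetal-resp-↭ p

  force-empty-pistil : IsEval w ρ → forceF w ρ (([] · []) ▷ Γ) ⇔ somePetal w ρ Γ
  force-empty-pistil {ρ = ρ} {Γ = Γ} ev = mk⇔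
    (λ f → somePetal-resp-≗ Γ (upd-[] _ ρ) (f _ ≤-refl ρ ev tt))
    (λ s w' le e₁ _ _ → somePetal-resp-≗ Γ (sym ∘ upd-[] _ e₁) (somePetal-mono Γ le s))

  force-empty-petal : IsEval w ρ → somePetal w ρ [ [] · Φ ] ⇔ forceB w ρ Φ
  force-empty-petal {ρ = ρ} {Φ = Φ} ev = mk⇔
    (λ { (inj₁ (e₂ , _ , h)) → forceB-resp-≗ Φ (upd-[] _ e₂) h })
    (λ h → inj₁ (ρ , ev , forceB-resp-≗ Φ (sym ∘ upd-[] _ ρ) h))

  -- Entailment in contexts

  infix 4 _⊢_⊑_ _⊑_ _≋_

  -- The side hypothesis Θ travels under binders that avoid its free variables; pollination uses
  -- Θ = [ φ ].
  record _⊢_⊑_ (Θ A B : Bouquet ar) : Set where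
    constructor entails
    field entail : ∀ w e → IsEval w e → forceB w e Θ → forceB w e A → forceB w e B
  open _⊢_⊑_ public

  _⊑_ : Bouquet ar → Bouquet ar → Set
  A ⊑ B = [] ⊢ A ⊑ B

  _≋_ : Bouquet ar → Bouquet ar → Set
  A ≋ B = A ⊑ B × B ⊑ A

  ⊑-refl : A ⊑ A
  ⊑-refl = entails λ _ _ _ _ → id

  ⊑-trans : ∀ {C} → A ⊑ B → B ⊑ C → A ⊑ C
  ⊑-trans A⊑B B⊑C = entails λ w e ev θ → entail B⊑C w e ev θ ∘ entail A⊑B w e ev θ

  ⊑-[] : A ⊑ []
  ⊑-[] = entails λ _ _ _ _ _ → tt

  ≋-sym : A ≋ B → B ≋ A
  ≋-sym (A⊑B , B⊑A) = B⊑A , A⊑B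

  ≋-trans : ∀ {C} → A ≋ B → B ≋ C → A ≋ C
  ≋-trans (A⊑B , B⊑A) (B⊑C , C⊑B) = ⊑-trans A⊑B B⊑C , ⊑-trans C⊑B B⊑A

  no-fv : ∀ l → Disjoint (fvB ar []) l
  no-fv _ (() , _)

  ++-⊑ : ∀ Ψ → Θ ⊢ A ⊑ B → Θ ⊢ Ψ ++ A ⊑ Ψ ++ B
  ++-⊑ Ψ A⊑B = entails λ w e ev θ h →
    let (ψ , a) = forceB-++⁻ Ψ h in forceB-++⁺ Ψ ψ (entail A⊑B w e ev θ a)

  pistil-⊑ : ∀ Θ → Disjoint (fvB ar Θ) x → Θ ⊢ A ⊑ B →
    Θ ⊢ [ (x · B) ▷ Δ ] ⊑ [ (x · A) ▷ Δ ]
  pistil-⊑ {x = x} Θ fresh A⊑B = entails λ { w e ev θ (f , _) →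
    (λ w' le e₁ ev₁ a → f w' le e₁ ev₁ (entail A⊑B w' _ (upd-IsEval x (IsEval-mono le ev) ev₁)
      (forceB-upd-fresh Θ fresh (forceB-mono Θ le θ)) a))
    , tt }

  corolla-⊑ : ∀ Θ → Disjoint (fvB ar Θ) x →
    (∀ w ρ → IsEval w ρ → forceB w ρ Θ → forceB w ρ Φ → somePetal w ρ Δ → somePetal w ρ Δ') →
    Θ ⊢ [ (x · Φ) ▷ Δ ] ⊑ [ (x · Φ) ▷ Δ' ]
  corolla-⊑ {x = x} Θ fresh Δ⇒Δ' = entails λ { w e ev θ (f , _) →
    (λ w' le e₁ ev₁ hΦ → Δ⇒Δ' w' _ (upd-IsEval x (IsEval-mono le ev) ev₁)
      (forceB-upd-fresh Θ fresh (forceB-mono Θ le θ)) hΦ (f w' le e₁ ev₁ hΦ))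
    , tt }

  petals-⊑ : (∀ w ρ → IsEval w ρ → forceB w ρ Φ → somePetal w ρ Δ → somePetal w ρ Δ') →
    [ (x · Φ) ▷ Δ ] ⊑ [ (x · Φ) ▷ Δ' ]
  petals-⊑ {x = x} Δ⇒Δ' = corolla-⊑ [] (no-fv x) (λ w ρ ev _ → Δ⇒Δ' w ρ ev)

  headPetal-⊑ : ∀ Θ → Disjoint (fvB ar Θ) y → Θ ⊢ A ⊑ B →
    IsEval w ρ → forceB w ρ Θ → somePetal w ρ ((y · A) ∷ Δ) → somePetal w ρ ((y · B) ∷ Δ)
  headPetal-⊑ {y = y} Θ fresh A⊑B ev θ = map₁ λ (e₂ , ev₂ , a) →
    e₂ , ev₂ , entail A⊑B _ _ (upd-IsEval y ev ev₂) (forceB-upd-fresh Θ fresh θ) a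

  petal-⊑ : ∀ Θ → Disjoint (fvB ar Θ) x → Disjoint (fvB ar Θ) y → Θ ⊢ A ⊑ B →
    Θ ⊢ [ (x · Φ) ▷ ((y · A) ∷ Δ) ] ⊑ [ (x · Φ) ▷ ((y · B) ∷ Δ) ]
  petal-⊑ {y = y} Θ fresh-x fresh-y A⊑B =
    corolla-⊑ Θ fresh-x (λ _ _ ev θ _ → headPetal-⊑ {y = y} Θ fresh-y A⊑B ev θ)

  fill-mono⁺ : ∀ Ξ → Positive ar Ξ → Disjoint (fvB ar Θ) (binders Ξ) →
    Θ ⊢ A ⊑ B → Θ ⊢ fill ar Ξ A ⊑ fill ar Ξ B
  fill-mono⁻ : ∀ Ξ → Negative ar Ξ → Disjoint (fvB ar Θ) (binders Ξ) →
    Θ ⊢ A ⊑ B → Θ ⊢ fill ar Ξ B ⊑ fill ar Ξ A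
  fill-mono⁺ (Ψ ,, □) _ _ A⊑B = ++-⊑ Ψ A⊑B
  fill-mono⁺ {Θ = Θ} (Ψ ,, pis x Ξ Δ) pos fresh A⊑B =
    let (fresh-x , fresh-Ξ) = Disjoint-++⁻ x fresh in
    ++-⊑ Ψ (pistil-⊑ Θ fresh-x (fill-mono⁻ Ξ (suc-even⇒odd (inv ar Ξ) pos) fresh-Ξ A⊑B))
  fill-mono⁺ {Θ = Θ} (Ψ ,, pet (x · Φ) y Ξ Δ) pos fresh A⊑B =
    let (fresh-x , fresh-yΞ) = Disjoint-++⁻ x fresh
        (fresh-y , fresh-Ξ) = Disjoint-++⁻ y fresh-yΞ in
    ++-⊑ Ψ (petal-⊑ Θ fresh-x fresh-y (fill-mono⁺ Ξ pos fresh-Ξ A⊑B))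
  fill-mono⁻ {Θ = Θ} (Ψ ,, pis x Ξ Δ) neg fresh A⊑B =
    let (fresh-x , fresh-Ξ) = Disjoint-++⁻ x fresh in
    ++-⊑ Ψ (pistil-⊑ Θ fresh-x (fill-mono⁺ Ξ (suc-odd⇒even (inv ar Ξ) neg) fresh-Ξ A⊑B))
  fill-mono⁻ {Θ = Θ} (Ψ ,, pet (x · Φ) y Ξ Δ) neg fresh A⊑B =
    let (fresh-x , fresh-yΞ) = Disjoint-++⁻ x fresh
        (fresh-y , fresh-Ξ) = Disjoint-++⁻ y fresh-yΞ in
    ++-⊑ Ψ (petal-⊑ Θ fresh-x fresh-y (fill-mono⁻ Ξ neg fresh-Ξ A⊑B))

  fill-cong : ∀ Ξ → Disjoint (fvB ar Θ) (binders Ξ) →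
    Θ ⊢ A ⊑ B → Θ ⊢ B ⊑ A → Θ ⊢ fill ar Ξ A ⊑ fill ar Ξ B
  fill-cong Ξ fresh A⊑B B⊑A with even-or-odd (inv ar Ξ)
  ... | inj₁ pos = fill-mono⁺ Ξ pos fresh A⊑B
  ... | inj₂ neg = fill-mono⁻ Ξ neg fresh B⊑A

  fill-≋ : ∀ Ξ → A ≋ B → fill ar Ξ A ≋ fill ar Ξ B
  fill-≋ Ξ (A⊑B , B⊑A) = fill-cong Ξ (no-fv _) A⊑B B⊑A , fill-cong Ξ (no-fv _) B⊑A A⊑B

  fill-plug-≋ : ∀ Ξ Ξ' → fill ar Ξ' A ≋ fill ar Ξ' B →
    fill ar (plug ar Ξ Ξ') A ≋ fill ar (plug ar Ξ Ξ') B
  fill-plug-≋ {A = A} {B = B} Ξ Ξ' A≋B =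
    subst₂ _≋_ (sym (fill-plug Ξ Ξ' A)) (sym (fill-plug Ξ Ξ' B)) (fill-≋ Ξ A≋B)

  -- Substitution, instantiation and renaming

  upd-∖ˢ : ∀ {σ} ρ x e₁ → NoCapture σ x → upd ρ x e₁ ∘ (σ ∖ˢ x) ≗ upd (ρ ∘ σ) x e₁
  upd-∖ˢ {σ} ρ x e₁ c v with v ∈? x
  ... | yes v∈x = upd-∈ v∈x
  ... | no v∉x with σ v ≟ℕ v
  ...   | yes σv≡v = trans (cong (upd ρ x e₁) σv≡v) (trans (upd-∉ v∉x) (cong ρ (sym σv≡v)))
  ...   | no moved = upd-∉ (c v moved)

  forceF-sub : ∀ σ φ → NoCapture σ (bvF ar φ) → forceF w ρ (subF ar σ φ) ⇔ forceF w (ρ ∘ σ) φ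
  forceB-sub : ∀ σ Φ → NoCapture σ (bvB ar Φ) → forceB w ρ (subB ar σ Φ) ⇔ forceB w (ρ ∘ σ) Φ
  somePetal-sub : ∀ σ Δ → NoCapture σ (bvGs ar Δ) →
    somePetal w ρ (subGs ar σ Δ) ⇔ somePetal w (ρ ∘ σ) Δ
  forceF-sub {w = w} {ρ = ρ} σ (atom p xs) _ =
    mk⇔ (subst (⟦ p ⟧ w) (sym (map-∘ ρ σ xs))) (subst (⟦ p ⟧ w) (map-∘ ρ σ xs))
  forceF-sub {ρ = ρ} σ ((x · Φ) ▷ Δ) c = mk⇔
    (λ f w' le e₁ ev₁ h → to (petals e₁) (f w' le e₁ ev₁ (from (pistil e₁) h)))
    (λ f w' le e₁ ev₁ h → from (petals e₁) (f w' le e₁ ev₁ (to (pistil e₁) h)))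
    where
    bound : ∀ e₁ → upd ρ x e₁ ∘ (σ ∖ˢ x) ≗ upd (ρ ∘ σ) x e₁
    bound e₁ = upd-∖ˢ ρ x e₁ (NoCapture-⊆ (λ m → ∈-++⁺ˡ (∈-++⁺ˡ m)) c)
    pistil : ∀ {w'} e₁ →
      forceB w' (upd ρ x e₁) (subB ar (σ ∖ˢ x) Φ) ⇔ forceB w' (upd (ρ ∘ σ) x e₁) Φ
    pistil e₁ = ⇔.trans (forceB-sub (σ ∖ˢ x) Φ (NoCapture-∖ˢ x _ (NoCapture-⊆ ∈-++⁺ˡ c)))
      (forceB-≗-⇔ Φ (bound e₁))
    petals : ∀ {w'} e₁ →
      somePetal w' (upd ρ x e₁) (subGs ar (σ ∖ˢ x) Δ) ⇔ somePetal w' (upd (ρ ∘ σ) x e₁) Δ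
    petals e₁ = ⇔.trans
      (somePetal-sub (σ ∖ˢ x) Δ
        (NoCapture-∖ˢ x _
          (NoCapture-⊆ ([ (λ m → ∈-++⁺ˡ (∈-++⁺ˡ m)) , ∈-++⁺ʳ _ ]′ ∘ ∈-++⁻ x) c)))
      (somePetal-≗-⇔ Δ (bound e₁))
  forceB-sub σ [] _ = mk⇔ id id
  forceB-sub σ (φ ∷ Φ) c =
    forceF-sub σ φ (NoCapture-⊆ ∈-++⁺ˡ c) ×-⇔ forceB-sub σ Φ (NoCapture-⊆ (∈-++⁺ʳ (bvF ar φ)) c)
  somePetal-sub σ [] _ = mk⇔ id id
  somePetal-sub {w = w} {ρ = ρ} σ ((z · Θ) ∷ Δ) c =
    witness ⊎-⇔ somePetal-sub σ Δ (NoCapture-⊆ (∈-++⁺ʳ _) c)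
    where
    body : ∀ e₂ → forceB w (upd ρ z e₂) (subB ar (σ ∖ˢ z) Θ) ⇔ forceB w (upd (ρ ∘ σ) z e₂) Θ
    body e₂ = ⇔.trans (forceB-sub (σ ∖ˢ z) Θ (NoCapture-∖ˢ z _ (NoCapture-⊆ ∈-++⁺ˡ c)))
      (forceB-≗-⇔ Θ (upd-∖ˢ ρ z e₂ (NoCapture-⊆ (λ m → ∈-++⁺ˡ (∈-++⁺ˡ m)) c)))
    witness : Witnessed w ρ z (subB ar (σ ∖ˢ z) Θ) ⇔ Witnessed w (ρ ∘ σ) z Θ
    witness = mk⇔ (λ (e₂ , ev₂ , h) → e₂ , ev₂ , to (body e₂) h)
                  (λ (e₂ , ev₂ , h) → e₂ , ev₂ , from (body e₂) h)

  upd-instantiate : ∀ {σ} → Supp σ y → ∀ e x e₁ →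
    upd e (x ++ y) (upd e x e₁ ∘ σ) ≗ upd e x e₁ ∘ σ
  upd-instantiate {y} {σ} supp e x e₁ v with v ∈? (x ++ y)
  ... | yes _ = refl
  ... | no v∉xy with σ v ≟ℕ v
  ...   | yes σv≡v =
    trans (sym (upd-∉ {x = x} {e = e} {e₁ = e₁} (v∉xy ∘ ∈-++⁺ˡ))) (cong (upd e x e₁) (sym σv≡v))
  ...   | no moved = ⊥-elim (v∉xy (∈-++⁺ʳ x (proj₂ (supp v) moved)))

  -- The pistil of the general flower is entered with the valuation upd e x e₁ ∘ σ on x ++ y.
  pistil-instantiate : ∀ {σ} → Supp σ y → CapAvoid ar σ y (bvF ar (([] · Φ) ▷ Δ)) → IsEval w e →
    forceF w e (((x ++ y) · Φ) ▷ Δ) → forceF w e ((x · subB ar σ Φ) ▷ subGs ar σ Δ)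
  pistil-instantiate {Φ = Φ} {Δ = Δ} {e = e} {x = x} {σ} supp ca ev f w' le e₁ ev₁ h =
    from (somePetal-sub σ Δ (NoCapture-⊆ (∈-++⁺ʳ (bvB ar Φ)) c))
      (somePetal-resp-≗ Δ (upd-instantiate supp e x e₁)
        (f w' le (upd e x e₁ ∘ σ) (λ v → upd-IsEval x (IsEval-mono le ev) ev₁ (σ v))
          (forceB-resp-≗ Φ (sym ∘ upd-instantiate supp e x e₁)
            (to (forceB-sub σ Φ (NoCapture-⊆ ∈-++⁺ˡ c)) h))))
    where
    c = CapAvoid⇒NoCapture supp ca

  petal-witness : ∀ {σ} → Supp σ y → CapAvoid ar σ y (bvB ar Φ) → IsEval w ρ →
    Witnessed w ρ x (subB ar σ Φ) → Witnessed w ρ (x ++ y) Φ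
  petal-witness {Φ = Φ} {ρ = ρ} {x = x} {σ} supp ca ev (e₂ , ev₂ , h) =
    upd ρ x e₂ ∘ σ , (λ v → upd-IsEval x ev ev₂ (σ v)) ,
    forceB-resp-≗ Φ (sym ∘ upd-instantiate supp ρ x e₂)
      (to (forceB-sub σ Φ (CapAvoid⇒NoCapture supp ca)) h)

  module Renaming (x : Sprinkler) {a b : Var} (a∈x : a ∈ x) (b∉x : b ∉ x) where

    x' : Sprinkler
    x' = map (rename a b) x

    ∉x⇒≢a : ∀ {v} → v ∉ x → v ≢ a
    ∉x⇒≢a v∉x refl = v∉x a∈x

    ∈⇒≢b : ∀ {v l} → b ∉ l → v ∈ l → v ≢ b
    ∈⇒≢b b∉l v∈l refl = b∉l v∈l

    upd-rename : ∀ e e₂ {v} → v ≢ b →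
      upd e x (upd e x' e₂ ∘ rename a b) v ≡ upd e x' e₂ (rename a b v)
    upd-rename e e₂ {v} v≢b with v ∈? x
    ... | yes _ = refl
    ... | no v∉x =
      trans (sym (upd-∉ (∉-map-rename v∉x v≢b))) (cong (upd e x' e₂) (sym (rename-other (∉x⇒≢a v∉x))))

    upd-rename⁻¹ : ∀ e e₁ {v} → v ≢ b →
      upd e x' (upd e x e₁ ∘ rename b a) (rename a b v) ≡ upd e x e₁ v
    upd-rename⁻¹ e e₁ {v} v≢b with v ∈? x
    ... | yes v∈x =
      trans (upd-∈ (∈-map⁺ (rename a b) v∈x))
        (trans (cong (upd e x e₁) (rename-inverse v≢b)) (upd-∈ v∈x))
    ... | no v∉x = trans (cong (upd e x' _) (rename-other (∉x⇒≢a v∉x))) (upd-∉ (∉-map-rename v∉x v≢b))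

    forceB-rename : ∀ Ψ → b ∉ fvB ar Ψ → b ∉ bvB ar Ψ →
      forceB w (upd e x' e₂) (subB ar (rename a b) Ψ) → forceB w (upd e x (upd e x' e₂ ∘ rename a b)) Ψ
    forceB-rename Ψ b∉fv b∉bv h = forceB-agree Ψ (λ m → sym (upd-rename _ _ (∈⇒≢b b∉fv m)))
      (to (forceB-sub (rename a b) Ψ (NoCapture-rename b∉bv)) h)

    forceB-rename⁻¹ : ∀ Ψ → b ∉ fvB ar Ψ → b ∉ bvB ar Ψ →
      forceB w (upd e x e₁) Ψ → forceB w (upd e x' (upd e x e₁ ∘ rename b a)) (subB ar (rename a b) Ψ)
    forceB-rename⁻¹ Ψ b∉fv b∉bv h = from (forceB-sub (rename a b) Ψ (NoCapture-rename b∉bv))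
      (forceB-agree Ψ (λ m → sym (upd-rename⁻¹ _ _ (∈⇒≢b b∉fv m))) h)

    αPis-≋ : ∀ Φ Δ → b ∉ fvF ar (([] · Φ) ▷ Δ) → b ∉ bvF ar (([] · Φ) ▷ Δ) →
      [ (x · Φ) ▷ Δ ] ≋ [ (x' · subB ar (rename a b) Φ) ▷ subGs ar (rename a b) Δ ]
    αPis-≋ Φ Δ b∉fv b∉bv =
      entails (λ { w e ev _ (f , _) → (λ w' le e₂ ev₂ h →
        from (somePetal-sub (rename a b) Δ capΔ)
          (somePetal-agree Δ (λ m → upd-rename e e₂ (∈⇒≢b b∉fvΔ m))
            (f w' le _ (λ v → upd-IsEval x' (IsEval-mono le ev) ev₂ (rename a b v))
              (forceB-rename Φ b∉fvΦ b∉bvΦ h))))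
        , tt }) ,
      entails (λ { w e ev _ (f , _) → (λ w' le e₁ ev₁ h →
        somePetal-agree Δ (λ m → upd-rename⁻¹ e e₁ (∈⇒≢b b∉fvΔ m))
          (to (somePetal-sub (rename a b) Δ capΔ)
            (f w' le _ (λ v → upd-IsEval x (IsEval-mono le ev) ev₁ (rename b a v))
              (forceB-rename⁻¹ Φ b∉fvΦ b∉bvΦ h))))
        , tt })
      where
      b∉fvΦ : b ∉ fvB ar Φ
      b∉fvΦ m = b∉fv (∈-++⁺ˡ (∈-minus⁺ [] m (λ ())))
      b∉fvΔ : b ∉ fvPet ar [] Δ
      b∉fvΔ = b∉fv ∘ ∈-++⁺ʳ _
      b∉bvΦ : b ∉ bvB ar Φ
      b∉bvΦ = b∉bv ∘ ∈-++⁺ˡ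
      capΔ : NoCapture (rename a b) (bvGs ar Δ)
      capΔ = NoCapture-rename (b∉bv ∘ ∈-++⁺ʳ (bvB ar Φ))

    αPet-≋ : ∀ γ Ψ Δ → b ∉ fvB ar Ψ → b ∉ bvB ar Ψ →
      [ γ ▷ ((x · Ψ) ∷ Δ) ] ≋ [ γ ▷ ((x' · subB ar (rename a b) Ψ) ∷ Δ) ]
    αPet-≋ (_ · _) Ψ Δ b∉fv b∉bv =
      petals-⊑ (λ _ ρ ev _ → map₁ λ (e₁ , ev₁ , h) →
        upd ρ x e₁ ∘ rename b a , (λ v → upd-IsEval x ev ev₁ (rename b a v)) ,
        forceB-rename⁻¹ Ψ b∉fv b∉bv h) ,
      petals-⊑ (λ _ ρ ev _ → map₁ λ (e₂ , ev₂ , h) →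
        upd ρ x' e₂ ∘ rename a b , (λ v → upd-IsEval x' ev ev₂ (rename a b v)) ,
        forceB-rename Ψ b∉fv b∉bv h)

  -- (∃ y. Ψ) ⇒ Δ is ∀ y. (Ψ ⇒ Δ) when y is not free in Δ.
  forceB-distribute⁺ : ∀ Γ → (∀ {y Ψ} → (y · Ψ) ∈ Γ → Disjoint y (fvPet ar [] Δ)) →
    (∀ w' → w ≤ w' → somePetal w' ρ Γ → somePetal w' ρ Δ) → forceB w ρ (map (λ γ → γ ▷ Δ) Γ)
  forceB-distribute⁺ [] _ _ = tt
  forceB-distribute⁺ {Δ = Δ} ((y · Ψ) ∷ Γ) fresh Γ⇒Δ =
    (λ w' le e₃ ev₃ h → somePetal-agree Δ (λ m → sym (upd-∉ (λ v∈y → fresh (here refl) (v∈y , m))))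
      (Γ⇒Δ w' le (inj₁ (e₃ , ev₃ , h)))) ,
    forceB-distribute⁺ Γ (fresh ∘ there) (λ w' le → Γ⇒Δ w' le ∘ inj₂)

  forceB-distribute⁻ : ∀ Γ → (∀ {y Ψ} → (y · Ψ) ∈ Γ → Disjoint y (fvPet ar [] Δ)) →
    forceB w ρ (map (λ γ → γ ▷ Δ) Γ) → somePetal w ρ Γ → somePetal w ρ Δ
  forceB-distribute⁻ {Δ = Δ} ((y · Ψ) ∷ Γ) fresh (f , _) (inj₁ (e₃ , ev₃ , h)) =
    somePetal-agree Δ (λ m → upd-∉ (λ v∈y → fresh (here refl) (v∈y , m))) (f _ ≤-refl e₃ ev₃ h)
  forceB-distribute⁻ ((y · Ψ) ∷ Γ) fresh (_ , fs) (inj₂ s) = forceB-distribute⁻ Γ (fresh ∘ there) fs s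

  srep-≋ : ∀ x Φ Γ Δ → WF ar [ (x · (Φ ++ [ ([] · []) ▷ Γ ])) ▷ Δ ] →
    [ (x · (Φ ++ [ ([] · []) ▷ Γ ])) ▷ Δ ] ≋ [ (x · Φ) ▷ [ [] · map (λ γ → γ ▷ Δ) Γ ] ]
  srep-≋ x Φ Γ Δ wf =
    entails (λ { w e ev _ (f , _) → (λ w' le e₁ ev₁ hΦ →
      let ρ-ev = upd-IsEval x (IsEval-mono le ev) ev₁ in
      from (force-empty-petal ρ-ev) (forceB-distribute⁺ Γ fresh λ w'' le' s →
        f w'' (≤-trans le le') e₁ (IsEval-mono le' ev₁)
          (forceB-++⁺ Φ (forceB-mono Φ le' hΦ) (from (force-empty-pistil (IsEval-mono le' ρ-ev)) s , tt))))
      , tt }) ,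
    entails (λ { w e ev _ (f , _) → (λ w' le e₁ ev₁ hΦF →
      let ρ-ev = upd-IsEval x (IsEval-mono le ev) ev₁
          (hΦ , hF , _) = forceB-++⁻ Φ hΦF in
      forceB-distribute⁻ Γ fresh (to (force-empty-petal ρ-ev) (f w' le e₁ ev₁ hΦ))
        (to (force-empty-pistil ρ-ev) hF))
      , tt })
    where
    fresh = srep-fresh x Φ Γ Δ wf

  nrule-≋ : WF ar Φ → NRule ar Φ Ψ → Φ ≋ Ψ
  nrule-≋ _ (epis Φ) =
    entails (λ _ _ ev _ h →
      from (force-empty-pistil {Γ = [ [] · Φ ]} ev) (from (force-empty-petal ev) h) , tt) ,
    entails (λ { _ _ ev _ (f , _) →
      to (force-empty-petal {Φ = Φ} ev) (to (force-empty-pistil {Γ = [ [] · Φ ]} ev) f) })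
  nrule-≋ _ (epet (_ · _) Δ) =
    ⊑-[] , entails (λ _ _ _ _ _ → (λ _ _ e₁ ev₁ _ → inj₁ (e₁ , ev₁ , tt)) , tt)
  nrule-≋ wf (srep x Φ Γ Δ) = srep-≋ x Φ Γ Δ wf
  nrule-≋ _ (ipis x y Φ Δ σ supp ca) =
    entails (λ { _ _ ev _ (f , _) → pistil-instantiate {x = x} supp ca ev f , f , tt }) ,
    entails (λ { _ _ _ _ (_ , f , _) → f , tt })
  nrule-≋ _ (ipet (_ · _) x y Φ Δ σ supp ca) =
    petals-⊑ (λ _ _ _ _ → inj₂) ,
    petals-⊑ (λ _ _ ev _ → [ inj₁ ∘ petal-witness {x = x} supp ca ev , id ]′)

  hyp-++-⊑ : φ ∈ Ψ → [ φ ] ⊢ A ⊑ B → Ψ ++ A ⊑ Ψ ++ B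
  hyp-++-⊑ {Ψ = Ψ} φ∈Ψ A⊑B = entails λ w e ev _ h →
    let (ψ , a) = forceB-++⁻ Ψ h in forceB-++⁺ Ψ ψ (entail A⊑B w e ev (forceB-∈ φ∈Ψ ψ , tt) a)

  drop-hyp : [ φ ] ⊢ φ ∷ A ⊑ A
  drop-hyp = entails λ _ _ _ _ → proj₂

  add-hyp : [ φ ] ⊢ A ⊑ φ ∷ A
  add-hyp = entails λ { _ _ _ (f , _) a → f , a }

  pollinate : ∀ Ξ C B → WF ar (fill ar Ξ C) → Pollinable ar φ Ξ → fill ar Ξ (φ ∷ B) ≋ fill ar Ξ B
  pollinate {φ = φ} .(plug ar Ξ' (addB ar Ψ (Ψ₀ ,, ξ))) C B wf
            (Ψ , φ∈Ψ , Ξ' , (Ψ₀ ,, ξ) , inj₁ refl) =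
    fill-plug-≋ Ξ' (addB ar Ψ (Ψ₀ ,, ξ))
      (hyp-++-⊑ φ∈ΨΨ₀ (fill-cong ([] ,, ξ) fresh drop-hyp add-hyp) ,
       hyp-++-⊑ φ∈ΨΨ₀ (fill-cong ([] ,, ξ) fresh add-hyp drop-hyp))
    where
    φ∈ΨΨ₀ : φ ∈ Ψ ++ Ψ₀
    φ∈ΨΨ₀ = ∈-++⁺ˡ φ∈Ψ
    fresh : Disjoint (fvB ar [ φ ]) (bindersF ξ)
    fresh (f , c) =
      fill-binders-fresh (addB ar Ψ (Ψ₀ ,, ξ)) C (WF-fill⁻ Ξ' _ (subst (WF ar) (fill-plug Ξ' _ C) wf))
        (∈-fvB (∈-++⁺ˡ φ∈ΨΨ₀) f , c)
  pollinate {φ = φ} .(plug ar Ξ' ([] ,, pet (x · Ψ) y Ξ₀ Δ)) C B wf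
            (Ψ , φ∈Ψ , Ξ' , Ξ₀ , inj₂ (x , y , Δ , refl)) =
    fill-plug-≋ Ξ' ([] ,, pet (x · Ψ) y Ξ₀ Δ)
      (petals-⊑ (inner drop-hyp add-hyp) , petals-⊑ (inner add-hyp drop-hyp))
    where
    wf' : WF ar [ (x · Ψ) ▷ ((y · fill ar Ξ₀ C) ∷ Δ) ]
    wf' = WF-fill⁻ Ξ' _ (subst (WF ar) (fill-plug Ξ' _ C) wf)
    fresh : Disjoint (fvB ar [ φ ]) (y ++ binders Ξ₀)
    fresh {v} (f , c) with v ∈? x
    ... | yes v∈x = Unique-++⇒Disjoint x (fill-binders-unique ([] ,, pet (x · Ψ) y Ξ₀ Δ) C wf') (v∈x , c)
    ... | no v∉x = fill-binders-fresh ([] ,, pet (x · Ψ) y Ξ₀ Δ) C wf'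
      (∈-++⁺ˡ (∈-++⁺ˡ (∈-minus⁺ x (∈-fvB φ∈Ψ f) v∉x)) , ∈-++⁺ʳ x c)
    inner : ∀ {A A'} → [ φ ] ⊢ A ⊑ A' → [ φ ] ⊢ A' ⊑ A →
      ∀ w ρ → IsEval w ρ → forceB w ρ Ψ →
      somePetal w ρ ((y · fill ar Ξ₀ A) ∷ Δ) → somePetal w ρ ((y · fill ar Ξ₀ A') ∷ Δ)
    inner A⊑A' A'⊑A _ _ ev ψ =
      let (fresh-y , fresh-Ξ₀) = Disjoint-++⁻ y fresh in
      headPetal-⊑ [ φ ] fresh-y (fill-cong Ξ₀ fresh-Ξ₀ A⊑A' A'⊑A) ev (forceB-∈ φ∈Ψ ψ , tt)

  pollinate-all : ∀ Ξ C Φ → WF ar (fill ar Ξ C) → PollinableB ar Φ Ξ → fill ar Ξ Φ ≋ fill ar Ξ []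
  pollinate-all Ξ C [] _ _ = ⊑-refl , ⊑-refl
  pollinate-all Ξ C (φ ∷ Φ) wf (p ∷ ps) =
    ≋-trans (pollinate Ξ C Φ wf p) (pollinate-all Ξ C Φ wf ps)

  step-sound : WF ar Φ → Step ar Φ Ψ → Ψ ⊑ Φ
  step-sound wf (nat Ξ {Φ} r) = proj₂ (fill-≋ Ξ (nrule-≋ (WF-fill⁻ Ξ Φ wf) r))
  step-sound wf (poll↓ Ξ Φ p) = proj₂ (pollinate-all Ξ Φ Φ wf p)
  step-sound wf (poll↑ Ξ Φ p) = proj₁ (pollinate-all Ξ [] Φ wf p)
  step-sound _ (grow Ξ Φ pos) = fill-mono⁺ Ξ pos (no-fv _) ⊑-[]
  step-sound _ (crop Ξ Φ neg) = fill-mono⁻ Ξ neg (no-fv _) ⊑-[]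
  step-sound _ (pull Ξ (_ · _) Γ Δ pos) =
    fill-mono⁺ Ξ pos (no-fv _) (petals-⊑ λ _ _ _ _ → somePetal-++⁺ʳ Γ)
  step-sound _ (glue Ξ (_ · _) Γ Δ neg) =
    fill-mono⁻ Ξ neg (no-fv _) (petals-⊑ λ _ _ _ _ → somePetal-++⁺ʳ Γ)
  step-sound _ (apis Ξ x y Φ Δ σ pos supp ca) = fill-mono⁺ Ξ pos (no-fv _)
    (entails λ { _ _ ev _ (f , _) → pistil-instantiate {x = x} supp ca ev f , tt })
  step-sound _ (apet Ξ (_ · _) x y Φ Δ σ neg supp ca) =
    fill-mono⁻ Ξ neg (no-fv _) (petals-⊑ λ _ _ ev _ → map₁ (petal-witness {x = x} supp ca ev))

  struct-≋ : Struct ar A B → A ≋ B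
  struct-≋ (perm p) =
    entails (λ _ _ _ _ → forceB-resp-↭ p) , entails (λ _ _ _ _ → forceB-resp-↭ (↭-sym p))
  struct-≋ (corolla (_ · _) p) =
    petals-⊑ (λ _ _ _ _ → somePetal-resp-↭ p) , petals-⊑ (λ _ _ _ _ → somePetal-resp-↭ (↭-sym p))
  struct-≋ (sprPis Φ Δ eq) = sprPis-⊑ eq , sprPis-⊑ (≈ˢ-sym eq)
    where
    sprPis-⊑ : x ≈ˢ y → [ (x · Φ) ▷ Δ ] ⊑ [ (y · Φ) ▷ Δ ]
    sprPis-⊑ eq = entails λ { _ _ _ _ (f , _) → (λ w' le e₁ ev₁ h →
      somePetal-resp-≗ Δ (upd-≈ˢ eq) (f w' le e₁ ev₁ (forceB-resp-≗ Φ (sym ∘ upd-≈ˢ eq) h))) , tt }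
  struct-≋ (sprPet (_ · _) Ψ Δ eq) =
    petals-⊑ (λ _ _ _ _ → map₁ (sprPet-witness eq)) ,
    petals-⊑ (λ _ _ _ _ → map₁ (sprPet-witness (≈ˢ-sym eq)))
    where
    sprPet-witness : x ≈ˢ y → Witnessed w ρ x Ψ → Witnessed w ρ y Ψ
    sprPet-witness eq (e₂ , ev₂ , h) = e₂ , ev₂ , forceB-resp-≗ Ψ (upd-≈ˢ eq) h
  struct-≋ (αPis x Φ Δ a b a∈x b∉x b∉fv b∉bv) = Renaming.αPis-≋ x a∈x b∉x Φ Δ b∉fv b∉bv
  struct-≋ (αPet γ y Ψ Δ a b a∈y b∉y b∉fv b∉bv) = Renaming.αPet-≋ y a∈y b∉y γ Ψ Δ b∉fv b∉bv

  ⟶*-sound : _⟶*_ ar Φ Ψ → Ψ ⊑ Φ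
  ⟶*-sound done = ⊑-refl
  ⟶*-sound (rule wf s d) = ⊑-trans (⟶*-sound d) (step-sound wf s)
  ⟶*-sound (equiv (Ξ , _ , _ , s , refl , refl) d) =
    ⊑-trans (⟶*-sound d) (proj₂ (fill-≋ Ξ ([ struct-≋ , ≋-sym ∘ struct-≋ ]′ s)))

mainTheorem3 : (P : Set) (ar : P → ℕ) (enc : P → ℕ) → Injective _≡_ _≡_ enc →
    (Φ Ψ : Bouquet ar) → _⟶*_ ar Φ Ψ → _⊨_ ar Ψ Φ
mainTheorem3 P ar _ _ Φ Ψ Φ⟶*Ψ K w e ev =
  Soundness.entail (Soundness.⟶*-sound ar K Φ⟶*Ψ) w e ev tt
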